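{- Let $S=\{s_1<\dots<s_n\}\subset\mathbb{N}$ be a symmetric set. Then every symmetry type of $S$ is one of $(1,n)$, $(2,n)$, or $(1,n-1)$.
   Context: For $R,R'\subset\mathbb{Q}$, $R'$ is a copy of $R$ if $R'=aR+b$ for some rational $a>0$ and rational $b$. $S$ (listed in increasing order as $s_1<\dots<s_n$) is symmetric if there exist $1\le i<j\le n$ such that $S\setminus\{s_i\}$ is a copy of $S\setminus\{s_j\}$; in this case $S$ has symmetry type $(i,j)$. -}

module Defs where

open import Data.Nat as ℕ using (ℕ)
open import Data.Integer using (+_)
open import Data.Rational using (ℚ; _/_; _+_; _*_; _<_; 0ℚ)
open import Data.Fin as Fin using (Fin)
open import Data.Product using (Σ; ∃; _×_)
open import Relation.Binary.PropositionalEquality using (_≡_; _≢_)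
open import Function.Bundles using (_⇔_)

ℕ→ℚ : ℕ → ℚ
ℕ→ℚ m = + m / 1

SubsetQ : Set₁
SubsetQ = ℚ → Set

-- S = {s_0 < ... < s_{n-1}} ⊂ ℕ given by its increasing enumeration (0-based indices)
StrictlyIncreasing : {n : ℕ} → (Fin n → ℕ) → Set
StrictlyIncreasing {n} s = ∀ (i j : Fin n) → i Fin.< j → s i ℕ.< s j

Remove : {n : ℕ} → (Fin n → ℕ) → Fin n → SubsetQ
Remove {n} s i x = Σ (Fin n) λ k → (k ≢ i) × (x ≡ ℕ→ℚ (s k))

IsCopy : SubsetQ → SubsetQ → Set
IsCopy R' R = Σ ℚ λ a → Σ ℚ λ b → (0ℚ < a) ×
  (∀ (x : ℚ) → R' x ⇔ (Σ ℚ λ y → R y × (x ≡ a * y + b)))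

-- S has symmetry type (i,j) (0-based): i < j and S\{s_i} is a copy of S\{s_j}
HasSymmetryType : {n : ℕ} → (Fin n → ℕ) → Fin n → Fin n → Set
HasSymmetryType s i j = (i Fin.< j) × IsCopy (Remove s i) (Remove s j)

-- A copy map x ↦ a x + b (a > 0) is strictly increasing, so it matches S ∖ {s_j} with
-- S ∖ {s_i} in order.  Every element below s_i is then a fixed point (by induction from
-- the bottom: the smallest unmatched element must go to itself), and likewise every
-- element above s_j (from the top).  An affine map with two fixed points is the
-- identity, which would fix s_i ∈ S ∖ {s_j} although s_i ∉ S ∖ {s_i}.  So at most one
-- index lies outside [i, j], which leaves only the types (1,n), (2,n) and (1,n-1).
module Submission where

open import Defs
open import Data.Nat as ℕ using (ℕ; suc; _∸_; z≤n; s≤s)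
import Data.Nat.Properties as ℕ
open import Data.Nat.Coprimality using (1-coprimeTo) renaming (sym to coprime-sym)
open import Data.Integer as ℤ using (+_)
import Data.Integer.Properties as ℤ
open import Data.Rational as ℚ using (ℚ; 0ℚ; 1ℚ; _+_; _*_; _-_; -_; 1/_)
import Data.Rational.Properties as ℚ
open import Data.Rational.Solver using (module +-*-Solver)
open import Data.Fin as Fin using (Fin; toℕ; fromℕ<)
import Data.Fin.Properties as Fin
open import Data.Fin.Induction using (<-wellFounded; >-wellFounded)
open import Data.Empty using (⊥; ⊥-elim)
open import Data.Product using (Σ; _×_; _,_)
open import Data.Sum using (_⊎_; inj₁; inj₂)
open import Function using (_∘_)
open import Level using (0ℓ)
open import Function.Bundles using (Equivalence)
open import Function.Definitions using (Injective)
open import Induction.WellFounded using (Acc; acc)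
open import Relation.Binary using (Rel; IsStrictTotalOrder; IsStrictPartialOrder; tri<; tri≈; tri>)
open import Relation.Binary.PropositionalEquality
open import Relation.Nullary using (¬_)

ℕ→ℚ-mono-< : ∀ {m n} → m ℕ.< n → ℕ→ℚ m ℚ.< ℕ→ℚ n
ℕ→ℚ-mono-< {m} {n} m<n
  rewrite ℚ.normalize-coprime (coprime-sym (1-coprimeTo m))
        | ℚ.normalize-coprime (coprime-sym (1-coprimeTo n))
  = ℚ.*<* (subst₂ ℤ._<_ (sym (ℤ.*-identityʳ (+ m))) (sym (ℤ.*-identityʳ (+ n))) (ℤ.+<+ m<n))

module StrictlyIncreasing
  {A B : Set} {_<₁_ : Rel A 0ℓ} {_<₂_ : Rel B 0ℓ}
  (<₁-isStrictTotalOrder : IsStrictTotalOrder _≡_ _<₁_)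
  (<₂-isStrictPartialOrder : IsStrictPartialOrder _≡_ _<₂_)
  {f : A → B} (f-mono : ∀ {x y} → x <₁ y → f x <₂ f y)
  where

  open IsStrictTotalOrder <₁-isStrictTotalOrder using (compare)
  open IsStrictPartialOrder <₂-isStrictPartialOrder using (irrefl; asym)

  injective : Injective _≡_ _≡_ f
  injective {x} {y} fx≡fy with compare x y
  ... | tri< x<y _ _ = ⊥-elim (irrefl fx≡fy (f-mono x<y))
  ... | tri≈ _ x≡y _ = x≡y
  ... | tri> _ _ y<x = ⊥-elim (irrefl (sym fx≡fy) (f-mono y<x))

  cancel-< : ∀ {x y} → f x <₂ f y → x <₁ y
  cancel-< {x} {y} fx<fy with compare x y
  ... | tri< x<y _ _ = x<y
  ... | tri≈ _ refl _ = ⊥-elim (irrefl refl fx<fy)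
  ... | tri> _ _ y<x = ⊥-elim (asym fx<fy (f-mono y<x))

Outside : ℕ → ℕ → ℕ → Set
Outside i j k = k ℕ.< i ⊎ j ℕ.< k

module DeletionMatching
  {X : Set} {_<_ : Rel X 0ℓ} (<-isStrictTotalOrder : IsStrictTotalOrder _≡_ _<_)
  {n : ℕ} (q : Fin n → X) (q-mono : ∀ {k l} → k Fin.< l → q k < q l)
  (f : X → X) (f-mono : ∀ {x y} → x < y → f x < f y)
  (i j : Fin n) (i<j : i Fin.< j)
  (forth : ∀ k → k ≢ i → Σ (Fin n) λ m → m ≢ j × q k ≡ f (q m))
  (back : ∀ m → m ≢ j → Σ (Fin n) λ k → k ≢ i × f (q m) ≡ q k)
  where

  open IsStrictTotalOrder <-isStrictTotalOrder using (isStrictPartialOrder)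
  open StrictlyIncreasing Fin.<-isStrictTotalOrder isStrictPartialOrder q-mono
    renaming (injective to q-injective; cancel-< to q-cancel-<)
  open StrictlyIncreasing Fin.<-isStrictTotalOrder isStrictPartialOrder (f-mono ∘ q-mono)
    renaming (injective to fq-injective)

  Fixed : Fin n → Set
  Fixed p = f (q p) ≡ q p

  -- If q p = f (q m) with m > p, then f (q p) = q k with k < p, and k is already fixed.
  fixed-below : ∀ p → p Fin.< i → Fixed p
  fixed-below p = go p (<-wellFounded p)
    where
    go : ∀ p → Acc Fin._<_ p → p Fin.< i → Fixed p
    go p (acc below) p<i with forth p (Fin.<⇒≢ p<i) | back p (Fin.<⇒≢ (Fin.<-trans p<i i<j))
    ... | m , _ , qp≡fqm | k , _ , fqp≡qk with Fin.<-cmp m p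
    ... | tri< m<p _ _ = ⊥-elim (Fin.<⇒≢ m<p (q-injective (trans (sym fixed-m) (sym qp≡fqm))))
      where
      fixed-m : Fixed m
      fixed-m = go m (below m<p) (Fin.<-trans m<p p<i)
    ... | tri≈ _ refl _ = sym qp≡fqm
    ... | tri> _ _ p<m = ⊥-elim (Fin.<⇒≢ k<p (fq-injective (trans fixed-k (sym fqp≡qk))))
      where
      k<p : k Fin.< p
      k<p = q-cancel-< (subst₂ _<_ fqp≡qk (sym qp≡fqm) (f-mono (q-mono p<m)))
      fixed-k : Fixed k
      fixed-k = go k (below k<p) (Fin.<-trans k<p p<i)

  fixed-above : ∀ p → j Fin.< p → Fixed p
  fixed-above p = go p (>-wellFounded p)
    where
    go : ∀ p → Acc Fin._>_ p → j Fin.< p → Fixed p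
    go p (acc above) j<p with forth p (Fin.<⇒≢ (Fin.<-trans i<j j<p) ∘ sym) | back p (Fin.<⇒≢ j<p ∘ sym)
    ... | m , _ , qp≡fqm | k , _ , fqp≡qk with Fin.<-cmp p m
    ... | tri< p<m _ _ = ⊥-elim (Fin.<⇒≢ p<m (q-injective (trans qp≡fqm fixed-m)))
      where
      fixed-m : Fixed m
      fixed-m = go m (above p<m) (Fin.<-trans j<p p<m)
    ... | tri≈ _ refl _ = sym qp≡fqm
    ... | tri> _ _ m<p = ⊥-elim (Fin.<⇒≢ p<k (fq-injective (trans fqp≡qk (sym fixed-k))))
      where
      p<k : p Fin.< k
      p<k = q-cancel-< (subst₂ _<_ (sym qp≡fqm) fqp≡qk (f-mono (q-mono m<p)))
      fixed-k : Fixed k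
      fixed-k = go k (above p<k) (Fin.<-trans j<p p<k)

  fixed-outside : ∀ p → Outside (toℕ i) (toℕ j) (toℕ p) → Fixed p
  fixed-outside p (inj₁ p<i) = fixed-below p p<i
  fixed-outside p (inj₂ j<p) = fixed-above p j<p

  removed-point-not-fixed : ¬ Fixed i
  removed-point-not-fixed fixed-i with back i (Fin.<⇒≢ i<j)
  ... | k , k≢i , fqi≡qk = k≢i (q-injective (trans (sym fqi≡qk) fixed-i))

affine : ℚ → ℚ → ℚ → ℚ
affine a b x = a * x + b

affine-mono-< : ∀ {a} b → 0ℚ ℚ.< a → ∀ {x y} → x ℚ.< y → affine a b x ℚ.< affine a b y
affine-mono-< {a} b 0<a x<y = ℚ.+-monoˡ-< b (ℚ.*-monoʳ-<-pos a {{ℚ.positive 0<a}} x<y)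

affine-two-fixed-points⇒id : ∀ {a b p r} → p ℚ.< r →
  affine a b p ≡ p → affine a b r ≡ r → ∀ x → affine a b x ≡ x
affine-two-fixed-points⇒id {a} {b} {p} {r} p<r fixed-p fixed-r x = begin
  a * x + b             ≡⟨ cong (λ c → c * x + b) slope≡1 ⟩
  1ℚ * x + b            ≡⟨ solve 3 (λ x b p → con 1ℚ :* x :+ b := x :+ ((con 1ℚ :* p :+ b) :- p)) refl x b p ⟩
  x + (1ℚ * p + b - p)  ≡⟨ cong (λ c → x + (c * p + b - p)) (sym slope≡1) ⟩
  x + (a * p + b - p)   ≡⟨ cong (λ y → x + (y - p)) fixed-p ⟩
  x + (p - p)           ≡⟨ solve 2 (λ x p → x :+ (p :- p) := x) refl x p ⟩
  x                     ∎
  where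
  open ≡-Reasoning
  open +-*-Solver
  d : ℚ
  d = r - p
  instance
    d-nonZero : ℚ.NonZero d
    d-nonZero = ℚ.pos⇒nonZero d {{ℚ.positive 0<d}}
      where
      0<d : 0ℚ ℚ.< d
      0<d = subst (ℚ._< d) (ℚ.+-inverseʳ p) (ℚ.+-monoˡ-< (- p) p<r)
  ad≡d : a * d ≡ d
  ad≡d = begin
    a * (r - p)                  ≡⟨ solve 4 (λ a b p r → a :* (r :- p) := (a :* r :+ b) :- (a :* p :+ b)) refl a b p r ⟩
    (a * r + b) - (a * p + b)    ≡⟨ cong₂ _-_ fixed-r fixed-p ⟩
    r - p                        ∎
  slope≡1 : a ≡ 1ℚ
  slope≡1 = begin
    a                ≡⟨ sym (ℚ.*-identityʳ a) ⟩
    a * 1ℚ           ≡⟨ cong (a *_) (sym (ℚ.*-inverseʳ d)) ⟩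
    a * (d * 1/ d)   ≡⟨ sym (ℚ.*-assoc a d (1/ d)) ⟩
    a * d * 1/ d     ≡⟨ cong (_* 1/ d) ad≡d ⟩
    d * 1/ d         ≡⟨ ℚ.*-inverseʳ d ⟩
    1ℚ               ∎

BoundaryType : ℕ → ℕ → ℕ → Set
BoundaryType n i j = ((i ≡ 0) × (j ≡ n ∸ 1)) ⊎ ((i ≡ 1) × (j ≡ n ∸ 1)) ⊎ ((i ≡ 0) × (j ≡ n ∸ 2))

-- The gap above j is written as n = d + suc j so that n ∸ 1 and n ∸ 2 reduce for d = 0, 1.
at-most-one-outside⇒BoundaryType : ∀ {n i j} → i ℕ.< j → j ℕ.< n →
  (∀ {k l} → k ℕ.< l → l ℕ.< n → Outside i j k → Outside i j l → ⊥) →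
  BoundaryType n i j
at-most-one-outside⇒BoundaryType {i = i} {j} i<j j<n no-two
  rewrite sym (ℕ.m∸n+n≡m j<n) = by-gap i _ i<j no-two
  where
  by-gap : ∀ i d → i ℕ.< j → (∀ {k l} → k ℕ.< l → l ℕ.< d ℕ.+ suc j → Outside i j k → Outside i j l → ⊥) →
           BoundaryType (d ℕ.+ suc j) i j
  by-gap 0 0 _ _ = inj₁ (refl , refl)
  by-gap 0 1 _ _ = inj₂ (inj₂ (refl , refl))
  by-gap 0 (suc (suc d)) _ no-two =
    ⊥-elim (no-two (ℕ.n<1+n _) (ℕ.n<1+n _) (inj₂ (ℕ.m≤n+m _ d)) (inj₂ (ℕ.m≤n⇒m≤1+n (ℕ.m≤n+m _ d))))
  by-gap 1 0 _ _ = inj₂ (inj₁ (refl , refl))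
  by-gap (suc (suc i)) 0 i<j no-two =
    ⊥-elim (no-two (ℕ.n<1+n 0) (ℕ.<-trans (s≤s (s≤s z≤n)) (s≤s i<j)) (inj₁ (s≤s z≤n)) (inj₁ (s≤s (s≤s z≤n))))
  by-gap (suc i) (suc d) _ no-two =
    ⊥-elim (no-two (ℕ.≤-<-trans z≤n (ℕ.m≤n+m _ d)) (ℕ.n<1+n _) (inj₁ (s≤s z≤n)) (inj₂ (ℕ.m≤n+m _ d)))

lemma3p4 : (n : ℕ) (s : Fin n → ℕ) → StrictlyIncreasing s →
    (i j : Fin n) → HasSymmetryType s i j →
    ((toℕ i ≡ 0) × (toℕ j ≡ n ∸ 1))
    ⊎ ((toℕ i ≡ 1) × (toℕ j ≡ n ∸ 1))
    ⊎ ((toℕ i ≡ 0) × (toℕ j ≡ n ∸ 2))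
lemma3p4 n s s-mono i j (i<j , a , b , 0<a , copy) =
  at-most-one-outside⇒BoundaryType i<j (Fin.toℕ<n j) no-two-outside
  where
  q : Fin n → ℚ
  q = ℕ→ℚ ∘ s

  forth : ∀ k → k ≢ i → Σ (Fin n) λ m → m ≢ j × q k ≡ affine a b (q m)
  forth k k≢i with Equivalence.to (copy (q k)) (k , k≢i , refl)
  ... | _ , (m , m≢j , refl) , qk≡fqm = m , m≢j , qk≡fqm

  back : ∀ m → m ≢ j → Σ (Fin n) λ k → k ≢ i × affine a b (q m) ≡ q k
  back m m≢j = Equivalence.from (copy (affine a b (q m))) (q m , (m , m≢j , refl) , refl)

  q-mono : ∀ {k l} → k Fin.< l → q k ℚ.< q l
  q-mono = ℕ→ℚ-mono-< ∘ s-mono _ _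

  open DeletionMatching ℚ.<-isStrictTotalOrder q q-mono (affine a b) (affine-mono-< b 0<a) i j i<j forth back

  fixed-at : ∀ {k} (k<n : k ℕ.< n) → Outside (toℕ i) (toℕ j) k → Fixed (fromℕ< k<n)
  fixed-at k<n = fixed-outside _ ∘ subst (Outside _ _) (sym (Fin.toℕ-fromℕ< k<n))

  no-two-outside : ∀ {k l} → k ℕ.< l → l ℕ.< n → Outside (toℕ i) (toℕ j) k → Outside (toℕ i) (toℕ j) l → ⊥
  no-two-outside {k} {l} k<l l<n outside-k outside-l = removed-point-not-fixed
    (affine-two-fixed-points⇒id {a} {b} (q-mono p<r) (fixed-at k<n outside-k) (fixed-at l<n outside-l) (q i))
    where
    k<n : k ℕ.< n
    k<n = ℕ.<-trans k<l l<n
    p<r : fromℕ< k<n Fin.< fromℕ< l<n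
    p<r = subst₂ ℕ._<_ (sym (Fin.toℕ-fromℕ< k<n)) (sym (Fin.toℕ-fromℕ< l<n)) k<l
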